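{- Let $k\ge2$, let $\Gamma$ be a system as in the context and let $H>0$. Then $$M_\Gamma(H)\le\frac{2^{k-1}H^{k-1}}{\prod_{i=1}^{k-1}\min(\gamma_i,H)}.$$ In particular, $M_\Gamma(H)\le 2^{k-1}H^{k-1}/\gamma(\Gamma)$ if $\gamma_i\le H$ for every $i$, and $M_\Gamma(H)\le 2^{k-1}H^{k-2}$ if $\gamma_j\ge H$ for some $j$.
   Context: A system $\Gamma=\{\gamma_{i,j}:\ 0\le i\ne j\le k-1\}$ consists of positive squarefree integers with $\gamma_{i,j}=\gamma_{j,i}$ and $\gcd(\gamma_{i,j},\gamma_{j,l})\mid\gamma_{i,l}$ for all distinct $i,j,l$. Put $\gamma_j=\operatorname{lcm}_{0\le i\le j-1}\gamma_{i,j}$ ($1\le j\le k-1$), $\gamma(\Gamma)=\gamma_1\cdots\gamma_{k-1}$, and let $c$ be the product of the distinct primes dividing $\gamma(\Gamma)$. For $\mathbf{h}=(h_1,\dots,h_{k-1})\in\mathbb{Z}^{k-1}$, with $h_0=0$, let $\Gamma(\mathbf{h})=\{\gcd(c,h_j-h_i)\}_{0\le i\ne j\le k-1}$. Define $M_\Gamma(H)=\#\{(h_1,\dots,h_{k-1})\in\mathbb{Z}^{k-1}:\ h_0=0,\ h_i\ne h_j\ (i\ne j),\ 0\le h_i\le H \ \forall i,\ \Gamma(\mathbf{h})=\Gamma\}$. -}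

module Defs where

open import Data.Nat using (ℕ; zero; suc; _*_; _<_; _<ᵇ_; _⊓_; ∣_-_∣)
open import Data.Nat.GCD using (gcd)
open import Data.Nat.LCM using (lcm)
open import Data.Nat.Divisibility using (_∣_; _∣?_)
open import Data.Nat.Primality using (Prime; prime?)
open import Data.Nat.Properties using (_≟_)
open import Data.Fin using (Fin; toℕ) renaming (zero to fzero; suc to fsuc)
open import Data.Fin.Properties using (all?) renaming (_≟_ to _≟ᶠ_)
open import Data.List using (List; []; _∷_; map; concatMap; upTo; filter; foldr; length; allFin)
open import Data.Vec using (Vec; lookup) renaming ([] to []ᵥ; _∷_ to _∷ᵥ_)
open import Data.Nat.ListAction using (product)
open import Data.Bool using (if_then_else_)
open import Data.Product using (_×_)
open import Relation.Nullary using (¬_; Dec; _×-dec_; _→-dec_; ¬?)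
open import Relation.Binary.PropositionalEquality using (_≡_; _≢_)

Squarefree : ℕ → Set
Squarefree m = ∀ p → Prime p → ¬ (p * p ∣ m)

-- A system Γ on indices 0..k-1 (values only meaningful for i ≠ j).
IsSystem : {k : ℕ} → (Fin k → Fin k → ℕ) → Set
IsSystem {k} Γ =
  (∀ i j → i ≢ j → 0 < Γ i j) ×
  (∀ i j → i ≢ j → Squarefree (Γ i j)) ×
  (∀ i j → i ≢ j → Γ i j ≡ Γ j i) ×
  (∀ i j l → i ≢ j → j ≢ l → i ≢ l → gcd (Γ i j) (Γ j l) ∣ Γ i l)

gammaIdx : {k : ℕ} → (Fin k → Fin k → ℕ) → Fin k → ℕ
gammaIdx {k} Γ j =
  foldr (λ i acc → if toℕ i <ᵇ toℕ j then lcm (Γ i j) acc else acc) 1 (allFin k)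

-- γ(Γ) = γ_1 ⋯ γ_{k-1}   (here k = suc n)
gammaTot : {n : ℕ} → (Fin (suc n) → Fin (suc n) → ℕ) → ℕ
gammaTot {n} Γ = product (map (λ j → gammaIdx Γ (fsuc j)) (allFin n))

minProd : {n : ℕ} → (Fin (suc n) → Fin (suc n) → ℕ) → ℕ → ℕ
minProd {n} Γ H = product (map (λ j → gammaIdx Γ (fsuc j) ⊓ H) (allFin n))

rad : ℕ → ℕ
rad m = product (filter (λ p → prime? p ×-dec (p ∣? m)) (upTo (suc m)))

cOf : {n : ℕ} → (Fin (suc n) → Fin (suc n) → ℕ) → ℕ
cOf Γ = rad (gammaTot Γ)

tuples : (n H : ℕ) → List (Vec ℕ n)
tuples zero H = []ᵥ ∷ []
tuples (suc n) H = concatMap (λ x → map (x ∷ᵥ_) (tuples n H)) (upTo (suc H))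

full : {n : ℕ} → Vec ℕ n → Vec ℕ (suc n)
full h = 0 ∷ᵥ h

Admissible : {n : ℕ} → (Fin (suc n) → Fin (suc n) → ℕ) → Vec ℕ n → Set
Admissible {n} Γ h =
  (∀ i j → i ≢ j → lookup (full h) i ≢ lookup (full h) j) ×
  (∀ i j → i ≢ j → gcd (cOf Γ) ∣ lookup (full h) j - lookup (full h) i ∣ ≡ Γ i j)

admissible? : {n : ℕ} → (Γ : Fin (suc n) → Fin (suc n) → ℕ) → (h : Vec ℕ n) → Dec (Admissible Γ h)
admissible? Γ h =
  all? (λ i → all? (λ j → ¬? (i ≟ᶠ j) →-dec ¬? (lookup (full h) i ≟ lookup (full h) j)))
  ×-dec
  all? (λ i → all? (λ j → ¬? (i ≟ᶠ j) →-dec (gcd (cOf Γ) ∣ lookup (full h) j - lookup (full h) i ∣ ≟ Γ i j)))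

M : {n : ℕ} → (Fin (suc n) → Fin (suc n) → ℕ) → ℕ → ℕ
M Γ H = length (filter (admissible? Γ) (tuples _ H))

-- If two admissible tuples agree in h₁, …, h_{j−1}, then for every i < j both h_j and h'_j are
-- congruent to h_i modulo γ_{i,j} = gcd(c, h_j − h_i), hence h_j ≡ h'_j modulo γ_j = lcm_i γ_{i,j}.
-- So once the earlier coordinates are fixed, the admissible values of h_j in [0, H] are at least
-- min(γ_j, H) apart, and there are at most 2H / min(γ_j, H) of them; multiplying over j gives the
-- first bound. The second is the case min(γ_j, H) = γ_j, and for the third the product of the
-- minima is at least H.
module Submission where

open import Defs
open import Data.Nat using (ℕ; zero; suc; z<s; _+_; _*_; _^_; _≤_; _<_; _∸_; _⊓_; ∣_-_∣; _<ᵇ_; _≤′_; ≤′-reflexive; ≤′-step; z≤n; s≤s; _<?_; _≤?_; >-nonZero)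
open import Data.Nat.Properties
open import Data.Nat.Divisibility using (_∣_; 1∣_; ∣⇒≤; ∣m+n∣m⇒∣n; ∣m∣n⇒∣m+n)
open import Data.Nat.GCD using (gcd; gcd[m,n]∣n)
open import Data.Nat.LCM using (lcm; lcm-least; gcd*lcm)
open import Data.Nat.Induction using (<-rec)
open import Data.Nat.ListAction using (sum; product)
open import Data.Nat.ListAction.Properties using (∈⇒≤product)
open import Data.Fin as Fin using (Fin; toℕ) renaming (zero to fzero; suc to fsuc)
open import Data.Fin.Properties using () renaming (<⇒≢ to <⇒≢ᶠ)
open import Data.List using (List; []; _∷_; [_]; _++_; map; concatMap; upTo; filter; length; foldr; tabulate; allFin)
open import Data.List.Properties using (upTo-∷ʳ; filter-++; filter-accept; filter-reject; length-++; length-map; map-tabulate; map-cong)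
open import Data.List.Relation.Unary.All using (_∷_)
open import Data.List.Relation.Unary.All.Properties using (all-filter; tabulate⁺) renaming (map⁺ to All-map⁺)
open import Data.List.Membership.Propositional.Properties using (∈-map⁺; ∈-allFin)
open import Data.Vec using (Vec; lookup) renaming ([] to []ᵥ; _∷_ to _∷ᵥ_)
open import Data.Bool using (true; false; T; if_then_else_)
open import Data.Product using (_×_; _,_; ∃; Σ)
open import Data.Sum using (inj₁; inj₂)
open import Function using (_∘_)
open import Data.Nat.Tactic.RingSolver using (solve-∀)
open import Algebra.Properties.CommutativeSemigroup *-commutativeSemigroup using (x∙yz≈xz∙y; xy∙z≈xz∙y)
open import Relation.Nullary using (¬_; yes; no)
open import Relation.Unary using (Decidable)
open import Relation.Binary.PropositionalEquality using (_≡_; _≢_; refl; sym; trans; cong; cong₂; subst; module ≡-Reasoning)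

∣-∣-between : ∀ {x y z} → x ≤ y → y ≤ z → ∣ x - z ∣ ≡ ∣ x - y ∣ + ∣ y - z ∣
∣-∣-between {x} x≤y y≤z with m≤n⇒∃[o]m+o≡n x≤y | m≤n⇒∃[o]m+o≡n y≤z
... | a , refl | b , refl = begin
  ∣ x - x + a + b ∣                 ≡⟨ cong ∣ x -_∣ (+-assoc x a b) ⟩
  ∣ x - x + (a + b) ∣               ≡⟨ ∣m-m+n∣≡n x (a + b) ⟩
  a + b                             ≡⟨ sym (cong₂ _+_ (∣m-m+n∣≡n x a) (∣m-m+n∣≡n (x + a) b)) ⟩
  ∣ x - x + a ∣ + ∣ x + a - x + a + b ∣ ∎
  where open ≡-Reasoning

_≡_[mod_] : ℕ → ℕ → ℕ → Set
x ≡ y [mod d ] = d ∣ ∣ x - y ∣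

module _ {d : ℕ} where

  ≡[mod]-sym : ∀ {x y} → x ≡ y [mod d ] → y ≡ x [mod d ]
  ≡[mod]-sym {x} {y} = subst (d ∣_) (∣-∣-comm x y)

  ≡[mod]-trans-≤ : ∀ {x y z} → x ≤ z → x ≡ y [mod d ] → y ≡ z [mod d ] → x ≡ z [mod d ]
  ≡[mod]-trans-≤ {x} {y} {z} x≤z x~y y~z with ≤-total y x
  ... | inj₁ y≤x = ∣m+n∣m⇒∣n (subst (d ∣_) (∣-∣-between y≤x x≤z) y~z) (≡[mod]-sym {x} x~y)
  ... | inj₂ x≤y with ≤-total y z
  ...   | inj₁ y≤z = subst (d ∣_) (sym (∣-∣-between x≤y y≤z)) (∣m∣n⇒∣m+n x~y y~z)
  ...   | inj₂ z≤y = ∣m+n∣m⇒∣n (subst (d ∣_) (trans (∣-∣-between x≤z z≤y) (+-comm ∣ x - z ∣ _)) x~y) (≡[mod]-sym {y} y~z)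

  ≡[mod]-trans : ∀ {x y z} → x ≡ y [mod d ] → y ≡ z [mod d ] → x ≡ z [mod d ]
  ≡[mod]-trans {x} {y} {z} x~y y~z with ≤-total x z
  ... | inj₁ x≤z = ≡[mod]-trans-≤ x≤z x~y y~z
  ... | inj₂ z≤x = ≡[mod]-sym {z} (≡[mod]-trans-≤ z≤x (≡[mod]-sym {y} y~z) (≡[mod]-sym {x} x~y))

Gapped : ℕ → (ℕ → Set) → Set
Gapped g P = ∀ {x y} → P x → P y → x < y → x + g ≤ y

≡[mod]⇒Gapped : ∀ {d} {P : ℕ → Set} → (∀ {x y} → P x → P y → x ≡ y [mod d ]) → Gapped d P
≡[mod]⇒Gapped {d} congruent {x} {y} px py x<y = begin
  x + d       ≤⟨ +-monoʳ-≤ x (∣⇒≤ ⦃ >-nonZero (m<n⇒0<n∸m x<y) ⦄ d∣y∸x) ⟩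
  x + (y ∸ x) ≡⟨ m+[n∸m]≡n (<⇒≤ x<y) ⟩
  y           ∎
  where
    open ≤-Reasoning
    d∣y∸x : d ∣ y ∸ x
    d∣y∸x = subst (d ∣_) (m≤n⇒∣m-n∣≡n∸m (<⇒≤ x<y)) (congruent px py)

Gapped-antimono : ∀ {g g'} {P : ℕ → Set} → g ≤ g' → Gapped g' P → Gapped g P
Gapped-antimono g≤g' gapped px py x<y = ≤-trans (+-monoʳ-≤ _ g≤g') (gapped px py x<y)

module _ {P : ℕ → Set} (P? : Decidable P) where

  countBelow : ℕ → ℕ
  countBelow m = length (filter P? (upTo m))

  countBelow-suc : ∀ m → countBelow (suc m) ≡ countBelow m + length (filter P? [ m ])
  countBelow-suc m = begin
    length (filter P? (upTo (suc m)))              ≡⟨ cong (length ∘ filter P?) (sym (upTo-∷ʳ m)) ⟩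
    length (filter P? (upTo m ++ [ m ]))           ≡⟨ cong length (filter-++ P? (upTo m) [ m ]) ⟩
    length (filter P? (upTo m) ++ filter P? [ m ]) ≡⟨ length-++ (filter P? (upTo m)) ⟩
    countBelow m + length (filter P? [ m ])        ∎
    where open ≡-Reasoning

  countBelow-suc-yes : ∀ {m} → P m → countBelow (suc m) ≡ suc (countBelow m)
  countBelow-suc-yes {m} pm =
    trans (countBelow-suc m) (trans (cong (λ l → countBelow m + length l) (filter-accept P? pm)) (+-comm _ 1))

  countBelow-suc-no : ∀ {m} → ¬ P m → countBelow (suc m) ≡ countBelow m
  countBelow-suc-no {m} ¬pm =
    trans (countBelow-suc m) (trans (cong (λ l → countBelow m + length l) (filter-reject P? ¬pm)) (+-identityʳ _))

  countBelow-stable : ∀ {n m} → n ≤′ m → (∀ {x} → n ≤ x → x < m → ¬ P x) → countBelow m ≡ countBelow n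
  countBelow-stable (≤′-reflexive refl) _ = refl
  countBelow-stable {m = suc m} (≤′-step n≤′m) none =
    trans (countBelow-suc-no (none (≤′⇒≤ n≤′m) (n<1+n m)))
          (countBelow-stable n≤′m (λ n≤x x<m → none n≤x (m<n⇒m<1+n x<m)))

  -- A point m of P leaves the g places before it empty, so the count jumps from below m ∸ g straight to m.
  countBelow-gapped-suc : ∀ {g} → Gapped (suc g) P → ∀ m → countBelow m * suc g ≤ m + g
  countBelow-gapped-suc {g} gapped = <-rec _ bound
    where
      bound : ∀ m → (∀ {k} → k < m → countBelow k * suc g ≤ k + g) → countBelow m * suc g ≤ m + g
      bound zero _ = z≤n
      bound (suc m) ih with P? m
      ... | no ¬pm = begin
        countBelow (suc m) * suc g ≡⟨ cong (_* suc g) (countBelow-suc-no ¬pm) ⟩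
        countBelow m * suc g       ≤⟨ ih ≤-refl ⟩
        m + g                      ≤⟨ +-monoˡ-≤ g (n≤1+n m) ⟩
        suc m + g                  ∎
        where open ≤-Reasoning
      ... | yes pm = begin
        countBelow (suc m) * suc g           ≡⟨ cong (_* suc g) (countBelow-suc-yes pm) ⟩
        suc g + countBelow m * suc g         ≡⟨ cong (λ c → suc g + c * suc g) (countBelow-stable (≤⇒≤′ (m∸n≤m m g)) too-close) ⟩
        suc g + countBelow (m ∸ g) * suc g   ≤⟨ +-monoʳ-≤ (suc g) earlier ⟩
        suc g + m                            ≡⟨ +-comm (suc g) m ⟩
        m + suc g                            ≡⟨ +-suc m g ⟩
        suc m + g                            ∎
        where
          open ≤-Reasoning
          too-close : ∀ {x} → m ∸ g ≤ x → x < m → ¬ P x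
          too-close {x} m∸g≤x x<m px = <⇒≱ (s≤s m≤x+g) (subst (_≤ m) (+-suc x g) (gapped px pm x<m))
            where
              m≤x+g : m ≤ x + g
              m≤x+g = ≤-trans (m≤n+m∸n m g) (≤-trans (+-monoʳ-≤ g m∸g≤x) (≤-reflexive (+-comm g x)))
          earlier : countBelow (m ∸ g) * suc g ≤ m
          earlier with g ≤? m
          ... | yes g≤m = ≤-trans (ih (s≤s (m∸n≤m m g))) (≤-reflexive (m∸n+n≡m g≤m))
          ... | no g≰m rewrite m≤n⇒m∸n≡0 (≰⇒≥ g≰m) = z≤n

  countBelow-gapped : ∀ {g} → Gapped g P → ∀ H → countBelow (suc H) * g ≤ H + g
  countBelow-gapped {zero} _ H = subst (_≤ H + 0) (sym (*-zeroʳ (countBelow (suc H)))) z≤n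
  countBelow-gapped {suc g} gapped H =
    subst (countBelow (suc H) * suc g ≤_) (sym (+-suc H g)) (countBelow-gapped-suc gapped (suc H))

module _ {A : Set} {P : A → Set} (P? : Decidable P) where

  filter-map : ∀ {B : Set} (f : B → A) xs → filter P? (map f xs) ≡ map f (filter (P? ∘ f) xs)
  filter-map f [] = refl
  filter-map f (x ∷ xs) with P? (f x)
  ... | yes _ = cong (f x ∷_) (filter-map f xs)
  ... | no _ = filter-map f xs

  length-filter-concatMap : ∀ {B : Set} (f : B → List A) xs →
    length (filter P? (concatMap f xs)) ≡ sum (map (λ x → length (filter P? (f x))) xs)
  length-filter-concatMap f [] = refl
  length-filter-concatMap f (x ∷ xs) = begin
    length (filter P? (f x ++ concatMap f xs))                   ≡⟨ cong length (filter-++ P? (f x) _) ⟩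
    length (filter P? (f x) ++ filter P? (concatMap f xs))        ≡⟨ length-++ (filter P? (f x)) ⟩
    length (filter P? (f x)) + length (filter P? (concatMap f xs)) ≡⟨ cong (_ +_) (length-filter-concatMap f xs) ⟩
    length (filter P? (f x)) + sum (map (λ y → length (filter P? (f y))) xs) ∎
    where open ≡-Reasoning

  filter-witness : ∀ xs → 0 < length (filter P? xs) → Σ A P
  filter-witness xs pos with filter P? xs | all-filter P? xs
  ... | y ∷ _ | py ∷ _ = y , py

sum-map-*-≤-support-* : ∀ {A : Set} {c b} (f : A → ℕ) → (∀ x → f x * c ≤ b) →
  ∀ xs → sum (map f xs) * c ≤ length (filter (λ x → 0 <? f x) xs) * b
sum-map-*-≤-support-* f fibre [] = z≤n
sum-map-*-≤-support-* {c = c} f fibre (x ∷ xs) with 0 <? f x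
... | yes fx>0 rewrite filter-accept (λ y → 0 <? f y) {xs = xs} fx>0 = begin
  (f x + sum (map f xs)) * c       ≡⟨ *-distribʳ-+ c (f x) _ ⟩
  f x * c + sum (map f xs) * c     ≤⟨ +-mono-≤ (fibre x) (sum-map-*-≤-support-* f fibre xs) ⟩
  _                                ∎
  where open ≤-Reasoning
... | no fx≯0 rewrite filter-reject (λ y → 0 <? f y) {xs = xs} fx≯0 | n≤0⇒n≡0 (≮⇒≥ fx≯0) =
  sum-map-*-≤-support-* f fibre xs

AgreeBelow : ∀ {r} → Fin r → Vec ℕ r → Vec ℕ r → Set
AgreeBelow {r} j t t' = ∀ (i : Fin r) → i Fin.< j → lookup t i ≡ lookup t' i

Separated : ∀ {r} → (Fin r → ℕ) → (Vec ℕ r → Set) → Set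
Separated D A = ∀ j {t t'} → A t → A t' → AgreeBelow j t t' → lookup t j ≡ lookup t' j [mod D j ]

separated-fibre : ∀ {r} {D : Fin (suc r) → ℕ} {A : Vec ℕ (suc r) → Set} → Separated D A →
  ∀ x → Separated (D ∘ fsuc) (A ∘ (x ∷ᵥ_))
separated-fibre sep x j a a' agree = sep (fsuc j) a a' λ where
  fzero _ → refl
  (fsuc i) (s≤s i<j) → agree i i<j

length-filter-tuples-suc : ∀ {r} {A : Vec ℕ (suc r) → Set} (A? : Decidable A) H →
  length (filter A? (tuples (suc r) H)) ≡ sum (map (λ x → length (filter (A? ∘ (x ∷ᵥ_)) (tuples r H))) (upTo (suc H)))
length-filter-tuples-suc {r} A? H =
  trans (length-filter-concatMap A? (λ x → map (x ∷ᵥ_) (tuples r H)) (upTo (suc H)))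
        (cong sum (map-cong fibre (upTo (suc H))))
  where
    fibre : ∀ x → length (filter A? (map (x ∷ᵥ_) (tuples r H))) ≡ length (filter (A? ∘ (x ∷ᵥ_)) (tuples r H))
    fibre x = trans (cong length (filter-map A? (x ∷ᵥ_) (tuples r H))) (length-map (x ∷ᵥ_) (filter (A? ∘ (x ∷ᵥ_)) (tuples r H)))

separated-count : ∀ r {A : Vec ℕ r → Set} (A? : Decidable A) {D : Fin r → ℕ} → Separated D A → ∀ H →
  length (filter A? (tuples r H)) * product (tabulate (λ j → D j ⊓ H)) ≤ 2 ^ r * H ^ r
separated-count zero A? sep H with A? []ᵥ
... | yes _ = ≤-refl
... | no _ = z≤n
separated-count (suc r) {A} A? {D} sep H = begin
  L * (D₀ * rest)             ≡⟨ x∙yz≈xz∙y L D₀ rest ⟩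
  L * rest * D₀               ≤⟨ *-monoˡ-≤ D₀ L*rest≤ ⟩
  occupied * B * D₀           ≡⟨ xy∙z≈xz∙y occupied B D₀ ⟩
  occupied * D₀ * B           ≤⟨ *-monoˡ-≤ B occupied≤ ⟩
  (H + H) * (2 ^ r * H ^ r)   ≡⟨ double H (2 ^ r) (H ^ r) ⟩
  2 ^ suc r * H ^ suc r       ∎
  where
    open ≤-Reasoning
    Ts : List (Vec ℕ r)
    Ts = tuples r H
    fibre : ℕ → ℕ
    fibre x = length (filter (A? ∘ (x ∷ᵥ_)) Ts)
    Occupied : ℕ → Set
    Occupied x = 0 < fibre x
    L = length (filter A? (tuples (suc r) H))
    D₀ = D fzero ⊓ H
    rest = product (tabulate (λ j → D (fsuc j) ⊓ H))
    B = 2 ^ r * H ^ r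
    occupied? : Decidable Occupied
    occupied? x = 0 <? fibre x
    occupied = countBelow occupied? (suc H)

    double : ∀ h p q → (h + h) * (p * q) ≡ 2 * p * (h * q)
    double = solve-∀

    L*rest≤ : L * rest ≤ occupied * B
    L*rest≤ = subst (λ l → l * rest ≤ occupied * B) (sym (length-filter-tuples-suc A? H))
      (sum-map-*-≤-support-* fibre (λ x → separated-count r (A? ∘ (x ∷ᵥ_)) (separated-fibre sep x) H) (upTo (suc H)))

    occupied-gapped : Gapped (D fzero) Occupied
    occupied-gapped = ≡[mod]⇒Gapped λ {x} {y} ox oy →
      congruent (filter-witness (A? ∘ (x ∷ᵥ_)) Ts ox) (filter-witness (A? ∘ (y ∷ᵥ_)) Ts oy)
      where
        congruent : ∀ {x y} → Σ _ (A ∘ (x ∷ᵥ_)) → Σ _ (A ∘ (y ∷ᵥ_)) → x ≡ y [mod D fzero ]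
        congruent (_ , a) (_ , a') = sep fzero a a' λ _ ()

    occupied≤ : occupied * D₀ ≤ H + H
    occupied≤ = ≤-trans (countBelow-gapped occupied? (Gapped-antimono (m⊓n≤m (D fzero) H) occupied-gapped) H)
                        (+-monoʳ-≤ H (m⊓n≤n (D fzero) H))

lcm-pos : ∀ {m n} → 0 < m → 0 < n → 0 < lcm m n
lcm-pos {m} {n} m>0 n>0 = n≢0⇒n>0 λ lcm≡0 → <⇒≢ (*-mono-< m>0 n>0) (sym (begin
  m * n             ≡⟨ sym (gcd*lcm m n) ⟩
  gcd m n * lcm m n ≡⟨ cong (gcd m n *_) lcm≡0 ⟩
  gcd m n * 0       ≡⟨ *-zeroʳ (gcd m n) ⟩
  0                 ∎))
  where open ≡-Reasoning

gammaIdx-lcmClosed : ∀ {k} (Γ : Fin k → Fin k → ℕ) (j : Fin k) (Q : ℕ → Set) →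
  Q 1 → (∀ {a b} → Q a → Q b → Q (lcm a b)) → (∀ i → i Fin.< j → Q (Γ i j)) → Q (gammaIdx Γ j)
gammaIdx-lcmClosed {k} Γ j Q Q1 Q-lcm QΓ = go (allFin k)
  where
    go : ∀ is → Q (foldr (λ i acc → if toℕ i <ᵇ toℕ j then lcm (Γ i j) acc else acc) 1 is)
    go [] = Q1
    go (i ∷ is) with toℕ i <ᵇ toℕ j in i<ᵇj
    ... | true = Q-lcm (QΓ i (<ᵇ⇒< (toℕ i) (toℕ j) (subst T (sym i<ᵇj) _))) (go is)
    ... | false = go is

module _ {n : ℕ} (Γ : Fin (suc n) → Fin (suc n) → ℕ) where

  gammaIdx-pos : IsSystem Γ → ∀ j → 0 < gammaIdx Γ j
  gammaIdx-pos (Γ-pos , _) j = gammaIdx-lcmClosed Γ j (0 <_) z<s lcm-pos (λ i i<j → Γ-pos i j (<⇒≢ᶠ i<j))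

  admissible-congruent : ∀ {h} → Admissible Γ h → ∀ {i j} → i ≢ j →
    lookup (full h) j ≡ lookup (full h) i [mod Γ i j ]
  admissible-congruent (_ , gcd≡Γ) {i} {j} i≢j = subst (_∣ _) (gcd≡Γ i j i≢j) (gcd[m,n]∣n (cOf Γ) _)

  admissible-separated : Separated (λ j → gammaIdx Γ (fsuc j)) (Admissible Γ)
  admissible-separated j {h} {h'} adm adm' agree =
    gammaIdx-lcmClosed Γ (fsuc j) (λ d → lookup h j ≡ lookup h' j [mod d ]) (1∣ _) lcm-least congruent
    where
      agree-full : ∀ i → i Fin.< fsuc j → lookup (full h) i ≡ lookup (full h') i
      agree-full fzero _ = refl
      agree-full (fsuc i) (s≤s i<j) = agree i i<j
      congruent : ∀ i → i Fin.< fsuc j → lookup h j ≡ lookup h' j [mod Γ i (fsuc j) ]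
      congruent i i<j = ≡[mod]-trans {x = lookup h j} {y = lookup (full h) i} (admissible-congruent adm (<⇒≢ᶠ i<j))
        (subst (λ y → y ≡ lookup h' j [mod Γ i (fsuc j) ]) (sym (agree-full i i<j))
          (≡[mod]-sym {x = lookup h' j} (admissible-congruent adm' (<⇒≢ᶠ i<j))))

≤-product-map-⊓ : ∀ {n} (γ : Fin n → ℕ) {H} → 0 < H → (∀ j → 0 < γ j) →
  ∀ j → H ≤ γ j → H ≤ product (map (λ i → γ i ⊓ H) (allFin n))
≤-product-map-⊓ γ {H} H>0 γ>0 j H≤γj =
  subst (_≤ _) (m≥n⇒m⊓n≡n H≤γj) (∈⇒≤product factors-nonZero (∈-map⁺ (λ i → γ i ⊓ H) (∈-allFin j)))
  where
    factors-nonZero = All-map⁺ (tabulate⁺ (λ i → >-nonZero (⊓-glb (γ>0 i) H>0)))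

corollary3p4 : (n : ℕ) → 1 ≤ n → (Γ : Fin (suc n) → Fin (suc n) → ℕ) → IsSystem Γ →
    (H : ℕ) → 0 < H →
    (M Γ H * minProd Γ H ≤ 2 ^ n * H ^ n)
    × ((∀ (i : Fin n) → gammaIdx Γ (fsuc i) ≤ H) → M Γ H * gammaTot Γ ≤ 2 ^ n * H ^ n)
    × (∃ (λ (j : Fin n) → H ≤ gammaIdx Γ (fsuc j)) → M Γ H ≤ 2 ^ n * H ^ (n ∸ 1))
corollary3p4 (suc n) (s≤s z≤n) Γ sys H H>0 = bound , all-small , one-large
  where
    bound : M Γ H * minProd Γ H ≤ 2 ^ suc n * H ^ suc n
    bound = subst (λ p → M Γ H * p ≤ 2 ^ suc n * H ^ suc n)
      (cong product (sym (map-tabulate (λ j → j) (λ j → gammaIdx Γ (fsuc j) ⊓ H))))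
      (separated-count (suc n) (admissible? Γ) (admissible-separated Γ) H)

    all-small : (∀ i → gammaIdx Γ (fsuc i) ≤ H) → M Γ H * gammaTot Γ ≤ 2 ^ suc n * H ^ suc n
    all-small γ≤H = subst (λ p → M Γ H * p ≤ 2 ^ suc n * H ^ suc n)
      (cong product (map-cong (λ i → m≤n⇒m⊓n≡m (γ≤H i)) (allFin (suc n)))) bound

    one-large : ∃ (λ j → H ≤ gammaIdx Γ (fsuc j)) → M Γ H ≤ 2 ^ suc n * H ^ n
    one-large (j , H≤γj) = *-cancelʳ-≤ (M Γ H) _ H ⦃ >-nonZero H>0 ⦄ (begin
      M Γ H * H               ≤⟨ *-monoʳ-≤ (M Γ H) (≤-product-map-⊓ _ H>0 (gammaIdx-pos Γ sys ∘ fsuc) j H≤γj) ⟩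
      M Γ H * minProd Γ H     ≤⟨ bound ⟩
      2 ^ suc n * (H * H ^ n) ≡⟨ x∙yz≈xz∙y (2 ^ suc n) H (H ^ n) ⟩
      2 ^ suc n * H ^ n * H   ∎)
      where open ≤-Reasoning
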